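{- Let $\alpha,\beta\in\Sigma^\omega$, with $\alpha=a\alpha'$ and $\beta=b\beta'$ where $a,b\in\Sigma$ and $\alpha',\beta'\in\Sigma^\omega$. Then: (1) if $a=b$ and $\tau(\alpha)=\tau(\beta)=2$, then $\alpha=\beta$; (2) if $a=b$ and $\tau(\alpha)<\tau(\beta)$, then $\alpha\prec\beta$; equivalently, if $a=b$ and $\alpha\preceq\beta$, then $\tau(\alpha)\le\tau(\beta)$.
   Context: $\Sigma$ is a finite alphabet with a total order $\preceq$, extended lexicographically to the set $\Sigma^\omega$ of right-infinite strings. For $\alpha=a\alpha'\in\Sigma^\omega$ with $a\in\Sigma$, $\tau(\alpha)=1$ if $\alpha'\prec\alpha$, $\tau(\alpha)=2$ if $\alpha'=\alpha$, and $\tau(\alpha)=3$ if $\alpha\prec\alpha'$. -}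

module Defs where

open import Data.Nat using (ℕ; zero; suc; _<_)
open import Data.Fin as Fin using (Fin)
open import Data.Product using (Σ; _×_)
open import Data.Sum using (_⊎_)
open import Data.Empty using (⊥)
open import Relation.Binary.PropositionalEquality using (_≡_)

-- The alphabet Σ: a finite totally ordered set, represented (up to order
-- isomorphism) by Fin m with its standard total order.
Alphabet : ℕ → Set
Alphabet m = Fin m

Word : ℕ → Set
Word m = ℕ → Alphabet m

hd : ∀ {m} → Word m → Alphabet m
hd α = α 0

tl : ∀ {m} → Word m → Word m
tl α n = α (suc n)

_≐_ : ∀ {m} → Word m → Word m → Set
α ≐ β = ∀ n → α n ≡ β n

_≺_ : ∀ {m} → Word m → Word m → Set
α ≺ β = Σ ℕ (λ n → (∀ k → k < n → α k ≡ β k) × (α n Fin.< β n))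

_⪯_ : ∀ {m} → Word m → Word m → Set
α ⪯ β = (α ≺ β) ⊎ (α ≐ β)

-- τ as a relation: Tau α t means τ(α) = t.
-- (Lexicographic comparison of infinite strings is not decidable, so τ is
-- rendered as its graph; by trichotomy exactly one of the three holds.)
Tau : ∀ {m} → Word m → ℕ → Set
Tau α 1 = tl α ≺ α
Tau α 2 = tl α ≐ α
Tau α 3 = α ≺ tl α
Tau α _ = ⊥

{-# OPTIONS --safe #-}
module Submission where

-- Each of τ(α) = 1, 2, 3 says that α is constantly a on an initial segment and
-- then drops below a, never leaves a, or rises above a, respectively. Two words
-- with the same first letter a therefore agree as long as both stay at a, and
-- the first position where one of them leaves a decides the comparison:
-- dropping < staying < rising. The converse form of (2) follows because
-- α ⪯ β excludes β ≺ α.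

open import Defs
open import Data.Nat using (ℕ; zero; suc; _<_; _≤_; s≤s; _≤?_)
open import Data.Nat.Properties using (<-cmp; <⇒≤; ≤-refl; ≤-trans; ≰⇒>)
open import Data.Fin as Fin using (Fin)
import Data.Fin.Properties as Finₚ
open import Data.Product using (Σ; _×_; _,_)
open import Data.Sum using (inj₁; inj₂)
open import Relation.Nullary using (¬_; yes; no; contradiction)
open import Relation.Binary.Definitions using (tri<; tri≈; tri>)
open import Relation.Binary.PropositionalEquality using (_≡_; refl; sym; trans; subst)

private
  variable
    m : ℕ

Run : Fin m → ℕ → Word m → Set
Run c n α = ∀ k → k ≤ n → α k ≡ c

Constant : Fin m → Word m → Set
Constant c α = ∀ k → α k ≡ c

Descent : Fin m → Word m → Set
Descent c α = Σ ℕ λ n → Run c n α × α (suc n) Fin.< c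

Ascent : Fin m → Word m → Set
Ascent c α = Σ ℕ λ n → Run c n α × c Fin.< α (suc n)

run-≺ : ∀ {c : Fin m} {n α β} → Run c n α → Run c n β →
        α (suc n) Fin.< β (suc n) → α ≺ β
run-≺ {n = n} {α} {β} runα runβ α<β = suc n , agree , α<β
  where
  agree : ∀ k → k < suc n → α k ≡ β k
  agree k (s≤s k≤n) = trans (runα k k≤n) (sym (runβ k k≤n))

descent-≺-constant : ∀ {c : Fin m} {α β} → Descent c α → Constant c β → α ≺ β
descent-≺-constant (n , runα , α<c) constβ =
  run-≺ runα (λ k _ → constβ k) (Finₚ.<-respʳ-≡ (sym (constβ (suc n))) α<c)

constant-≺-ascent : ∀ {c : Fin m} {α β} → Constant c α → Ascent c β → α ≺ β
constant-≺-ascent constα (n , runβ , c<β) =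
  run-≺ (λ k _ → constα k) runβ (Finₚ.<-respˡ-≡ (sym (constα (suc n))) c<β)

descent-≺-ascent : ∀ {c : Fin m} {α β} → Descent c α → Ascent c β → α ≺ β
descent-≺-ascent (n , runα , α<c) (p , runβ , c<β) with <-cmp n p
... | tri< n<p _ _ =
  run-≺ runα (λ k k≤n → runβ k (≤-trans k≤n (<⇒≤ n<p)))
        (Finₚ.<-respʳ-≡ (sym (runβ (suc n) n<p)) α<c)
... | tri≈ _ refl _ = run-≺ runα runβ (Finₚ.<-trans α<c c<β)
... | tri> _ _ p<n =
  run-≺ (λ k k≤p → runα k (≤-trans k≤p (<⇒≤ p<n))) runβ
        (Finₚ.<-respˡ-≡ (sym (runα (suc p) p<n)) c<β)

⪯⇒⊁ : ∀ {α β : Word m} → α ⪯ β → ¬ (β ≺ α)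
⪯⇒⊁ (inj₂ α≐β) (n , _ , β<α) = Finₚ.<-irrefl (sym (α≐β n)) β<α
⪯⇒⊁ (inj₁ (n , α≡β , α<β)) (p , β≡α , β<α) with <-cmp n p
... | tri< n<p _ _ = Finₚ.<-irrefl (sym (β≡α n n<p)) α<β
... | tri≈ _ refl _ = Finₚ.<-asym α<β β<α
... | tri> _ _ p<n = Finₚ.<-irrefl (sym (α≡β p p<n)) β<α

tl-agree⇒run : ∀ {α : Word m} {n} → (∀ k → k < n → tl α k ≡ α k) → Run (hd α) n α
tl-agree⇒run agree zero    _   = refl
tl-agree⇒run agree (suc k) k<n = trans (agree k k<n) (tl-agree⇒run agree k (<⇒≤ k<n))

τ≡1⇒descent : ∀ {α : Word m} → Tau α 1 → Descent (hd α) α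
τ≡1⇒descent {α = α} (n , agree , αₙ₊₁<αₙ) =
  n , run , Finₚ.<-respʳ-≡ (run n ≤-refl) αₙ₊₁<αₙ
  where
  run : Run (hd α) n α
  run = tl-agree⇒run agree

τ≡3⇒ascent : ∀ {α : Word m} → Tau α 3 → Ascent (hd α) α
τ≡3⇒ascent {α = α} (n , agree , αₙ<αₙ₊₁) =
  n , run , Finₚ.<-respˡ-≡ (run n ≤-refl) αₙ<αₙ₊₁
  where
  run : Run (hd α) n α
  run = tl-agree⇒run (λ k k<n → sym (agree k k<n))

τ≡2⇒constant : ∀ {α : Word m} → Tau α 2 → Constant (hd α) α
τ≡2⇒constant τ≡2 zero    = refl
τ≡2⇒constant τ≡2 (suc k) = trans (τ≡2 k) (τ≡2⇒constant τ≡2 k)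

τ<τ⇒≺ : ∀ {α β : Word m} → hd α ≡ hd β →
        ∀ s t → Tau α s → Tau β t → s < t → α ≺ β
τ<τ⇒≺ {β = β} a≡b 1 2 τα τβ _ =
  descent-≺-constant (τ≡1⇒descent τα) (subst (λ c → Constant c β) (sym a≡b) (τ≡2⇒constant τβ))
τ<τ⇒≺ {β = β} a≡b 1 3 τα τβ _ =
  descent-≺-ascent (τ≡1⇒descent τα) (subst (λ c → Ascent c β) (sym a≡b) (τ≡3⇒ascent τβ))
τ<τ⇒≺ {β = β} a≡b 2 3 τα τβ _ =
  constant-≺-ascent (τ≡2⇒constant τα) (subst (λ c → Ascent c β) (sym a≡b) (τ≡3⇒ascent τβ))
τ<τ⇒≺ _ 0 _ () _ _
τ<τ⇒≺ _ _ 0 _ () _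
τ<τ⇒≺ _ _ (suc (suc (suc (suc _)))) _ () _
τ<τ⇒≺ _ (suc _) 1 _ _ (s≤s ())
τ<τ⇒≺ _ (suc (suc _)) 2 _ _ (s≤s (s≤s ()))
τ<τ⇒≺ _ (suc (suc (suc _))) 3 _ _ (s≤s (s≤s (s≤s ())))

⪯⇒τ≤τ : ∀ {α β : Word m} → hd α ≡ hd β → α ⪯ β →
        ∀ s t → Tau α s → Tau β t → s ≤ t
⪯⇒τ≤τ a≡b α⪯β s t τα τβ with s ≤? t
... | yes s≤t = s≤t
... | no  s≰t = contradiction (τ<τ⇒≺ (sym a≡b) t s τβ τα (≰⇒> s≰t)) (⪯⇒⊁ α⪯β)

corollary3 : ∀ {m} (α β : Word m)
    → ((hd α ≡ hd β) → Tau α 2 → Tau β 2 → α ≐ β)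
      × ((hd α ≡ hd β) → ∀ s t → Tau α s → Tau β t → s < t → α ≺ β)
      × ((hd α ≡ hd β) → α ⪯ β → ∀ s t → Tau α s → Tau β t → s ≤ t)
corollary3 α β = τ≡2⇒≐ , τ<τ⇒≺ , ⪯⇒τ≤τ
  where
  τ≡2⇒≐ : hd α ≡ hd β → Tau α 2 → Tau β 2 → α ≐ β
  τ≡2⇒≐ a≡b τα τβ k = trans (τ≡2⇒constant τα k) (trans a≡b (sym (τ≡2⇒constant τβ k)))
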